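{- Let $\mathbb{M}$ be one of $\mathsf{K},\mathsf{D},\mathsf{T},\mathsf{K4},\mathsf{S4}$. There is no $2_{\mathbb{M}}$-proof of the empty 2-sequent $\ \vdash\ $ (both sides empty).
   Context: Modal formulas are built from countably many proposition symbols using $\neg,\wedge,\vee,\to,\Box,\Diamond$. Fix a countably infinite set of tokens; a position is a finite (possibly empty) sequence of tokens, $\circ$ is concatenation, $\alpha\circ x$ abbreviates $\alpha\circ\langle x\rangle$, and $\beta\preceq\alpha$ means $\beta$ is a prefix of $\alpha$. A p-formula is $A^\alpha$ with $A$ a modal formula and $\alpha$ a position; a 2-sequent is $\Gamma\vdash\Delta$ with $\Gamma,\Delta$ finite (possibly empty) sequences of p-formulas; $I(\Gamma)=\{\beta:\exists A^\alpha\in\Gamma,\ \beta\preceq\alpha\}$. The calculus $2_{\mathsf{S4}}$: Axiom $A^\alpha\vdash A^\alpha$; Cut: from $\Gamma_1\vdash A^\alpha,\Delta_1$ and $\Gamma_2,A^\alpha\vdash\Delta_2$ infer $\Gamma_1,\Gamma_2\vdash\Delta_1,\Delta_2$; weakening, contraction, exchange on both sides; the classical propositional sequent rules for $\neg,\wedge,\vee,\to$ (two-premise rules with contexts joined) in which all active p-formulas carry the same position; modal rules: from $\Gamma,A^{\alpha\circ\beta}\vdash\Delta$ infer $\Gamma,(\Box A)^\alpha\vdash\Delta$; from $\Gamma\vdash A^{\alpha\circ x},\Delta$ infer $\Gamma\vdash(\Box A)^\alpha,\Delta$; from $\Gamma,A^{\alpha\circ x}\vdash\Delta$ infer $\Gamma,(\Diamond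 A)^\alpha\vdash\Delta$; from $\Gamma\vdash A^{\alpha\circ\beta},\Delta$ infer $\Gamma\vdash(\Diamond A)^\alpha,\Delta$; $\beta$ a position, $x$ a token, and for the rules introducing $\Box$ on the right and $\Diamond$ on the left one requires $\alpha\circ x\notin I(\Gamma,\Delta)$. The calculi $2_{\mathsf T},2_{\mathsf D},2_{\mathsf{K4}},2_{\mathsf K}$ add constraints on the rules introducing $\Box$ on the left and $\Diamond$ on the right: $2_{\mathsf T}$: $\beta$ empty or a single token; $2_{\mathsf D}$: $\beta$ a single token; $2_{\mathsf{K4}}$: $\beta$ nonempty and $\Gamma$ or $\Delta$ contains some $B^{\alpha\circ\beta\circ\eta}$; $2_{\mathsf K}$: $\beta$ a single token and $\Gamma$ or $\Delta$ contains some $B^{\alpha\circ\beta\circ\eta}$. In $2_{\mathsf K},2_{\mathsf{K4}}$ Cut requires $\alpha\in I(\Gamma_1,\Delta_1)$ or $\alpha\in I(\Gamma_2,\Delta_2)$. -}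

module Defs where

open import Data.Nat using (ℕ)
open import Data.List using (List; []; _∷_; _++_; _∷ʳ_; [_]; length)
open import Data.List.Membership.Propositional using (_∈_)
open import Data.Product using (Σ; ∃; _×_; _,_)
open import Data.Sum using (_⊎_)
open import Relation.Binary.PropositionalEquality using (_≡_)
open import Relation.Nullary using (¬_)

data Formula : Set where
  var  : ℕ → Formula
  ¬'_  : Formula → Formula
  _∧'_ : Formula → Formula → Formula
  _∨'_ : Formula → Formula → Formula
  _⇒'_ : Formula → Formula → Formula
  □_   : Formula → Formula
  ◇_   : Formula → Formula

Token : Set
Token = ℕ

-- Positions: finite sequences of tokens; concatenation is _++_,
-- α ∘ x is α ∷ʳ x.
Pos : Set
Pos = List Token

_⪯_ : Pos → Pos → Set
β ⪯ α = ∃ λ γ → β ++ γ ≡ α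

record PFormula : Set where
  constructor _^_
  field
    fml : Formula
    pos : Pos
open PFormula public

_∈I_ : Pos → List PFormula → Set
β ∈I Γ = ∃ λ P → (P ∈ Γ) × (β ⪯ pos P)

ContainsExt : List PFormula → Pos → Set
ContainsExt Γ δ = ∃ λ P → (P ∈ Γ) × (δ ⪯ pos P)

data Logic : Set where
  K D T K4 S4 : Logic

ShiftOK : Logic → Pos → Pos → List PFormula → List PFormula → Set
ShiftOK S4 α β Γ Δ = Data.Unit.⊤ where import Data.Unit
ShiftOK T  α β Γ Δ = (β ≡ []) ⊎ (∃ λ x → β ≡ [ x ])
ShiftOK D  α β Γ Δ = ∃ λ x → β ≡ [ x ]
ShiftOK K4 α β Γ Δ = (¬ (β ≡ [])) × (ContainsExt Γ (α ++ β) ⊎ ContainsExt Δ (α ++ β))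
ShiftOK K  α β Γ Δ = (∃ λ x → β ≡ [ x ]) × (ContainsExt Γ (α ++ β) ⊎ ContainsExt Δ (α ++ β))

CutOK : Logic → Pos → List PFormula → List PFormula → List PFormula → List PFormula → Set
CutOK K  α Γ₁ Δ₁ Γ₂ Δ₂ = (α ∈I (Γ₁ ++ Δ₁)) ⊎ (α ∈I (Γ₂ ++ Δ₂))
CutOK K4 α Γ₁ Δ₁ Γ₂ Δ₂ = (α ∈I (Γ₁ ++ Δ₁)) ⊎ (α ∈I (Γ₂ ++ Δ₂))
CutOK D  α Γ₁ Δ₁ Γ₂ Δ₂ = Data.Unit.⊤ where import Data.Unit
CutOK T  α Γ₁ Δ₁ Γ₂ Δ₂ = Data.Unit.⊤ where import Data.Unit
CutOK S4 α Γ₁ Δ₁ Γ₂ Δ₂ = Data.Unit.⊤ where import Data.Unit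

data _∣_⊢_ (M : Logic) : List PFormula → List PFormula → Set where
  ax   : ∀ {P} → M ∣ [ P ] ⊢ [ P ]
  cut  : ∀ {Γ₁ Δ₁ Γ₂ Δ₂ A α} → CutOK M α Γ₁ Δ₁ Γ₂ Δ₂ →
         M ∣ Γ₁ ⊢ ((A ^ α) ∷ Δ₁) → M ∣ (Γ₂ ∷ʳ (A ^ α)) ⊢ Δ₂ →
         M ∣ (Γ₁ ++ Γ₂) ⊢ (Δ₁ ++ Δ₂)
  wkL  : ∀ {Γ Δ P} → M ∣ Γ ⊢ Δ → M ∣ (Γ ∷ʳ P) ⊢ Δ
  wkR  : ∀ {Γ Δ P} → M ∣ Γ ⊢ Δ → M ∣ Γ ⊢ (P ∷ Δ)
  ctrL : ∀ {Γ Δ P} → M ∣ ((Γ ∷ʳ P) ∷ʳ P) ⊢ Δ → M ∣ (Γ ∷ʳ P) ⊢ Δ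
  ctrR : ∀ {Γ Δ P} → M ∣ Γ ⊢ (P ∷ P ∷ Δ) → M ∣ Γ ⊢ (P ∷ Δ)
  exL  : ∀ {Γ₁ Γ₂ Δ P Q} → M ∣ (Γ₁ ++ P ∷ Q ∷ Γ₂) ⊢ Δ → M ∣ (Γ₁ ++ Q ∷ P ∷ Γ₂) ⊢ Δ
  exR  : ∀ {Γ Δ₁ Δ₂ P Q} → M ∣ Γ ⊢ (Δ₁ ++ P ∷ Q ∷ Δ₂) → M ∣ Γ ⊢ (Δ₁ ++ Q ∷ P ∷ Δ₂)
  ¬L   : ∀ {Γ Δ A α} → M ∣ Γ ⊢ ((A ^ α) ∷ Δ) → M ∣ (Γ ∷ʳ ((¬' A) ^ α)) ⊢ Δ
  ¬R   : ∀ {Γ Δ A α} → M ∣ (Γ ∷ʳ (A ^ α)) ⊢ Δ → M ∣ Γ ⊢ (((¬' A) ^ α) ∷ Δ)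
  ∧L₁  : ∀ {Γ Δ A B α} → M ∣ (Γ ∷ʳ (A ^ α)) ⊢ Δ → M ∣ (Γ ∷ʳ ((A ∧' B) ^ α)) ⊢ Δ
  ∧L₂  : ∀ {Γ Δ A B α} → M ∣ (Γ ∷ʳ (B ^ α)) ⊢ Δ → M ∣ (Γ ∷ʳ ((A ∧' B) ^ α)) ⊢ Δ
  ∧R   : ∀ {Γ₁ Γ₂ Δ₁ Δ₂ A B α} → M ∣ Γ₁ ⊢ ((A ^ α) ∷ Δ₁) → M ∣ Γ₂ ⊢ ((B ^ α) ∷ Δ₂) →
         M ∣ (Γ₁ ++ Γ₂) ⊢ (((A ∧' B) ^ α) ∷ (Δ₁ ++ Δ₂))
  ∨L   : ∀ {Γ₁ Γ₂ Δ₁ Δ₂ A B α} → M ∣ (Γ₁ ∷ʳ (A ^ α)) ⊢ Δ₁ → M ∣ (Γ₂ ∷ʳ (B ^ α)) ⊢ Δ₂ →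
         M ∣ ((Γ₁ ++ Γ₂) ∷ʳ ((A ∨' B) ^ α)) ⊢ (Δ₁ ++ Δ₂)
  ∨R₁  : ∀ {Γ Δ A B α} → M ∣ Γ ⊢ ((A ^ α) ∷ Δ) → M ∣ Γ ⊢ (((A ∨' B) ^ α) ∷ Δ)
  ∨R₂  : ∀ {Γ Δ A B α} → M ∣ Γ ⊢ ((B ^ α) ∷ Δ) → M ∣ Γ ⊢ (((A ∨' B) ^ α) ∷ Δ)
  ⇒L   : ∀ {Γ₁ Γ₂ Δ₁ Δ₂ A B α} → M ∣ Γ₁ ⊢ ((A ^ α) ∷ Δ₁) → M ∣ (Γ₂ ∷ʳ (B ^ α)) ⊢ Δ₂ →
         M ∣ ((Γ₁ ++ Γ₂) ∷ʳ ((A ⇒' B) ^ α)) ⊢ (Δ₁ ++ Δ₂)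
  ⇒R   : ∀ {Γ Δ A B α} → M ∣ (Γ ∷ʳ (A ^ α)) ⊢ ((B ^ α) ∷ Δ) → M ∣ Γ ⊢ (((A ⇒' B) ^ α) ∷ Δ)
  □L   : ∀ {Γ Δ A α β} → ShiftOK M α β Γ Δ →
         M ∣ (Γ ∷ʳ (A ^ (α ++ β))) ⊢ Δ → M ∣ (Γ ∷ʳ ((□ A) ^ α)) ⊢ Δ
  □R   : ∀ {Γ Δ A α x} → ¬ ((α ∷ʳ x) ∈I (Γ ++ Δ)) →
         M ∣ Γ ⊢ ((A ^ (α ∷ʳ x)) ∷ Δ) → M ∣ Γ ⊢ (((□ A) ^ α) ∷ Δ)
  ◇L   : ∀ {Γ Δ A α x} → ¬ ((α ∷ʳ x) ∈I (Γ ++ Δ)) →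
         M ∣ (Γ ∷ʳ (A ^ (α ∷ʳ x))) ⊢ Δ → M ∣ (Γ ∷ʳ ((◇ A) ^ α)) ⊢ Δ
  ◇R   : ∀ {Γ Δ A α β} → ShiftOK M α β Γ Δ →
         M ∣ Γ ⊢ ((A ^ (α ++ β)) ∷ Δ) → M ∣ Γ ⊢ (((◇ A) ^ α) ∷ Δ)

module Submission where

-- The empty 2-sequent is underivable in every calculus 2_M, by a soundness
-- argument for the "modal collapse" semantics: fix a classical valuation
-- v of the proposition symbols, read □ and ◇ as the identity and forget all
-- positions.  A p-formula A^α is then true iff A is true under v (read as a
-- classical formula), and a sequent Γ ⊢ Δ is valid when truth of all of Γ
-- implies truth of some member of Δ.  Truth is decidable, so the classical
-- right rules for ¬ and ⇒ can be justified constructively.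
--
-- Induction on
-- derivations then gives soundness for every logic M, ignoring all
-- side conditions.  The empty sequent is not valid, since Any over [] is
-- empty, which proves the theorem.

open import Defs
open import Data.Bool using (Bool; true) renaming (T to IsTrue)
open import Data.Empty using (⊥-elim)
open import Data.List using (List; []; _∷_; _++_; _∷ʳ_)
open import Data.List.Relation.Unary.All using (All; []; _∷_)
open import Data.List.Relation.Unary.Any using (Any; here; there)
open import Data.List.Relation.Binary.Permutation.Propositional using (_↭_; swap; ↭-refl)
open import Data.List.Relation.Binary.Permutation.Propositional.Properties using (All-resp-↭; Any-resp-↭; ++⁺ˡ)
open import Data.Nat using (ℕ)
open import Data.Product using (_×_; _,_; proj₁)
open import Data.Sum using (_⊎_; inj₁; inj₂)
open import Function using (_∘_)
open import Relation.Nullary using (¬_; Dec; yes; no)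
open import Relation.Nullary.Decidable using (T?; ¬?; _×-dec_; _⊎-dec_; _→-dec_)
import Data.List.Relation.Unary.All.Properties as All
import Data.List.Relation.Unary.Any.Properties as Any

module Collapse (v : ℕ → Bool) where

  ⟦_⟧ : Formula → Set
  ⟦ var n ⟧  = IsTrue (v n)
  ⟦ ¬' A ⟧   = ¬ ⟦ A ⟧
  ⟦ A ∧' B ⟧ = ⟦ A ⟧ × ⟦ B ⟧
  ⟦ A ∨' B ⟧ = ⟦ A ⟧ ⊎ ⟦ B ⟧
  ⟦ A ⇒' B ⟧ = ⟦ A ⟧ → ⟦ B ⟧
  ⟦ □ A ⟧    = ⟦ A ⟧
  ⟦ ◇ A ⟧    = ⟦ A ⟧

  -- Truth is decidable; this replaces excluded middle in ¬R and ⇒R.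
  ⟦_⟧? : (A : Formula) → Dec ⟦ A ⟧
  ⟦ var n ⟧?  = T? (v n)
  ⟦ ¬' A ⟧?   = ¬? ⟦ A ⟧?
  ⟦ A ∧' B ⟧? = ⟦ A ⟧? ×-dec ⟦ B ⟧?
  ⟦ A ∨' B ⟧? = ⟦ A ⟧? ⊎-dec ⟦ B ⟧?
  ⟦ A ⇒' B ⟧? = ⟦ A ⟧? →-dec ⟦ B ⟧?
  ⟦ □ A ⟧?    = ⟦ A ⟧?
  ⟦ ◇ A ⟧?    = ⟦ A ⟧?

  True : PFormula → Set
  True P = ⟦ fml P ⟧

  Valid : List PFormula → List PFormula → Set
  Valid Γ Δ = All True Γ → Any True Δ

  cut-valid : ∀ {Γ₁ Δ₁ Γ₂ Δ₂ P} → Valid Γ₁ (P ∷ Δ₁) → Valid (Γ₂ ∷ʳ P) Δ₂ →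
              Valid (Γ₁ ++ Γ₂) (Δ₁ ++ Δ₂)
  cut-valid {Γ₁} {Δ₁} d e h with All.++⁻ Γ₁ h
  ... | h₁ , h₂ with d h₁
  ... | here p  = Any.++⁺ʳ Δ₁ (e (All.∷ʳ⁺ h₂ p))
  ... | there s = Any.++⁺ˡ s

  ctrL-valid : ∀ {Γ Δ P} → Valid ((Γ ∷ʳ P) ∷ʳ P) Δ → Valid (Γ ∷ʳ P) Δ
  ctrL-valid d h with All.∷ʳ⁻ h
  ... | _ , p = d (All.∷ʳ⁺ h p)

  ctrR-valid : ∀ {Γ Δ P} → Valid Γ (P ∷ P ∷ Δ) → Valid Γ (P ∷ Δ)
  ctrR-valid d h with d h
  ... | here p          = here p
  ... | there (here p)  = here p
  ... | there (there s) = there s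

  adjacent-swap : ∀ (Γ₁ : List PFormula) {Γ₂ P Q} →
                  Γ₁ ++ P ∷ Q ∷ Γ₂ ↭ Γ₁ ++ Q ∷ P ∷ Γ₂
  adjacent-swap Γ₁ {P = P} {Q} = ++⁺ˡ Γ₁ (swap P Q ↭-refl)

  strengthen-last : ∀ {Γ Δ P Q} → (True P → True Q) →
                    Valid (Γ ∷ʳ Q) Δ → Valid (Γ ∷ʳ P) Δ
  strengthen-last f d h with All.∷ʳ⁻ h
  ... | h′ , p = d (All.∷ʳ⁺ h′ (f p))

  weaken-head : ∀ {Γ Δ P Q} → (True Q → True P) →
                Valid Γ (Q ∷ Δ) → Valid Γ (P ∷ Δ)
  weaken-head f d h with d h
  ... | here q  = here (f q)
  ... | there s = there s

  ¬L-valid : ∀ {Γ Δ A α} → Valid Γ ((A ^ α) ∷ Δ) → Valid (Γ ∷ʳ ((¬' A) ^ α)) Δ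
  ¬L-valid d h with All.∷ʳ⁻ h
  ... | h′ , ¬a with d h′
  ... | here a  = ⊥-elim (¬a a)
  ... | there s = s

  ¬R-valid : ∀ {Γ Δ A α} → Valid (Γ ∷ʳ (A ^ α)) Δ → Valid Γ (((¬' A) ^ α) ∷ Δ)
  ¬R-valid {A = A} d h with ⟦ A ⟧?
  ... | yes a = there (d (All.∷ʳ⁺ h a))
  ... | no ¬a = here ¬a

  ∧R-valid : ∀ {Γ₁ Γ₂ Δ₁ Δ₂ A B α} → Valid Γ₁ ((A ^ α) ∷ Δ₁) → Valid Γ₂ ((B ^ α) ∷ Δ₂) →
             Valid (Γ₁ ++ Γ₂) (((A ∧' B) ^ α) ∷ (Δ₁ ++ Δ₂))
  ∧R-valid {Γ₁} {Δ₁ = Δ₁} d e h with All.++⁻ Γ₁ h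
  ... | h₁ , h₂ with d h₁ | e h₂
  ... | here a  | here b  = here (a , b)
  ... | there s | _       = there (Any.++⁺ˡ s)
  ... | here _  | there s = there (Any.++⁺ʳ Δ₁ s)

  ∨L-valid : ∀ {Γ₁ Γ₂ Δ₁ Δ₂ A B α} → Valid (Γ₁ ∷ʳ (A ^ α)) Δ₁ → Valid (Γ₂ ∷ʳ (B ^ α)) Δ₂ →
             Valid ((Γ₁ ++ Γ₂) ∷ʳ ((A ∨' B) ^ α)) (Δ₁ ++ Δ₂)
  ∨L-valid {Γ₁} {Δ₁ = Δ₁} d e h with All.∷ʳ⁻ h
  ... | h₁₂ , a⊎b with All.++⁻ Γ₁ h₁₂
  ... | h₁ , h₂ with a⊎b
  ... | inj₁ a = Any.++⁺ˡ (d (All.∷ʳ⁺ h₁ a))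
  ... | inj₂ b = Any.++⁺ʳ Δ₁ (e (All.∷ʳ⁺ h₂ b))

  ⇒L-valid : ∀ {Γ₁ Γ₂ Δ₁ Δ₂ A B α} → Valid Γ₁ ((A ^ α) ∷ Δ₁) → Valid (Γ₂ ∷ʳ (B ^ α)) Δ₂ →
             Valid ((Γ₁ ++ Γ₂) ∷ʳ ((A ⇒' B) ^ α)) (Δ₁ ++ Δ₂)
  ⇒L-valid {Γ₁} {Δ₁ = Δ₁} d e h with All.∷ʳ⁻ h
  ... | h₁₂ , a⇒b with All.++⁻ Γ₁ h₁₂
  ... | h₁ , h₂ with d h₁
  ... | here a  = Any.++⁺ʳ Δ₁ (e (All.∷ʳ⁺ h₂ (a⇒b a)))
  ... | there s = Any.++⁺ˡ s

  ⇒R-valid : ∀ {Γ Δ A B α} → Valid (Γ ∷ʳ (A ^ α)) ((B ^ α) ∷ Δ) →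
             Valid Γ (((A ⇒' B) ^ α) ∷ Δ)
  ⇒R-valid {A = A} d h with ⟦ A ⟧?
  ... | no ¬a = here (⊥-elim ∘ ¬a)
  ... | yes a with d (All.∷ʳ⁺ h a)
  ... | here b  = here (λ _ → b)
  ... | there s = there s

  sound : ∀ {M Γ Δ} → M ∣ Γ ⊢ Δ → Valid Γ Δ
  sound ax                    (p ∷ []) = here p
  sound (cut _ d e)           = cut-valid (sound d) (sound e)
  sound (wkL d)               = sound d ∘ proj₁ ∘ All.∷ʳ⁻
  sound (wkR d)               = there ∘ sound d
  sound (ctrL d)              = ctrL-valid (sound d)
  sound (ctrR d)              = ctrR-valid (sound d)
  sound (exL {Γ₁} d)          = sound d ∘ All-resp-↭ (adjacent-swap Γ₁)
  sound (exR {Δ₁ = Δ₁} d)     = Any-resp-↭ (adjacent-swap Δ₁) ∘ sound d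
  sound (¬L d)                = ¬L-valid (sound d)
  sound (¬R d)                = ¬R-valid (sound d)
  sound (∧L₁ d)               = strengthen-last (λ (a , _) → a) (sound d)
  sound (∧L₂ d)               = strengthen-last (λ (_ , b) → b) (sound d)
  sound (∧R d e)              = ∧R-valid (sound d) (sound e)
  sound (∨L d e)              = ∨L-valid (sound d) (sound e)
  sound (∨R₁ d)               = weaken-head inj₁ (sound d)
  sound (∨R₂ d)               = weaken-head inj₂ (sound d)
  sound (⇒L d e)              = ⇒L-valid (sound d) (sound e)
  sound (⇒R d)                = ⇒R-valid (sound d)
  sound (□L _ d)              = strengthen-last (λ a → a) (sound d)
  sound (□R _ d)              = weaken-head (λ a → a) (sound d)
  sound (◇L _ d)              = strengthen-last (λ a → a) (sound d)
  sound (◇R _ d)              = weaken-head (λ a → a) (sound d)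

mainTheorem3 : (M : Logic) → ¬ (M ∣ [] ⊢ [])
mainTheorem3 M d with Collapse.sound (λ _ → true) d []
... | ()
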